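{- Let $n\ge1$ and let $\vec x\in\mathbb{R}^n$ be a spectrum. Then the spectral polyhedron $P(\vec x)$ is nonempty.
   Context: A spectrum is a vector $\vec a=(a_1,\dots,a_n)\in\mathbb{R}^n$ with $0<a_1<\dots<a_n$. For a spectrum $\vec a\in\mathbb{R}^n$, the spectral polyhedron $P(\vec a)\subseteq\mathbb{R}^n$ is the set of all $\vec y\in\mathbb{R}^n$ satisfying: (i) $y_i\ge 1$ for all $i$; (ii) $y_j-y_i\ge1$ for all $i<j$; (iii) for all $i\le j<k$ with $a_i+a_j\ge a_k$: $y_i+y_j-y_k\ge 0$; (iv) for all $i\le j<k$ with $a_i+a_j<a_k$: $y_k-y_i-y_j\ge1$. -}

module Defs where

open import Level using (Level; suc; _⊔_)
open import Data.Nat using (ℕ)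
open import Data.Fin using (Fin) renaming (_<_ to _<ᶠ_; _≤_ to _≤ᶠ_)
open import Data.Product using (Σ; _×_; ∃)
open import Data.Sum using (_⊎_)
open import Relation.Nullary using (¬_)
open import Relation.Binary.Structures using (IsStrictTotalOrder)
open import Algebra.Bundles using (CommutativeRing)

-- We state the theorem
-- for an arbitrary ordered field (a commutative ring with a strict total
-- order compatible with + and *, in which nonzero elements are invertible);
-- the real field ℝ is an instance.
record OrderedField (c ℓ : Level) : Set (suc (c ⊔ ℓ)) where
  field
    commutativeRing : CommutativeRing c ℓ
  open CommutativeRing commutativeRing public
  infix 4 _<_
  field
    _<_                 : Carrier → Carrier → Set ℓ
    <-isStrictTotalOrder : IsStrictTotalOrder _≈_ _<_
    0<1                 : 0# < 1#
    +-monoˡ-<           : ∀ {x y} z → x < y → x + z < y + z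
    *-pos               : ∀ {x y} → 0# < x → 0# < y → 0# < x * y
    inverse             : ∀ x → ¬ (x ≈ 0#) → Σ Carrier (λ y → x * y ≈ 1#)

  infix 4 _≤_
  _≤_ : Carrier → Carrier → Set ℓ
  x ≤ y = (x < y) ⊎ (x ≈ y)

module _ {c ℓ : Level} (F : OrderedField c ℓ) where
  open OrderedField F

  IsSpectrum : (n : ℕ) → (Fin n → Carrier) → Set ℓ
  IsSpectrum n a = (∀ i → 0# < a i) × (∀ i j → i <ᶠ j → a i < a j)

  InSpectralPolyhedron : (n : ℕ) → (a y : Fin n → Carrier) → Set ℓ
  InSpectralPolyhedron n a y =
      (∀ i → 1# ≤ y i)
    × (∀ i j → i <ᶠ j → 1# ≤ y j - y i)
    × (∀ i j k → i ≤ᶠ j → j <ᶠ k → a k ≤ a i + a j → 0# ≤ (y i + y j) - y k)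
    × (∀ i j k → i ≤ᶠ j → j <ᶠ k → a i + a j < a k → 1# ≤ (y k - y i) - y j)

  SpectralPolyhedronNonempty : (n : ℕ) → (Fin n → Carrier) → Set (c ⊔ ℓ)
  SpectralPolyhedronNonempty n a = ∃ λ y → InSpectralPolyhedron n a y

{-# OPTIONS --safe #-}

-- We look for a point of P(a) of the form y = κ a with κ > 0. Each constraint (iii)
-- is then κ times its own hypothesis a_k ≤ a_i + a_j, so it holds. The remaining
-- constraints ask that finitely many linear forms of y, each positive at y = a, be at
-- least 1; choosing δ > 0 below all of these finitely many positive values and
-- κ = 1/δ makes them hold as well.

module Submission where

open import Defs
open import Level using (Level; _⊔_)
import Data.Nat as Nat
open import Data.Fin using (Fin; zero; suc)
open import Data.Product using (Σ; _×_; _,_; proj₁; uncurry)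
open import Data.Sum using (_⊎_; inj₁; inj₂; [_,_])
open import Data.Empty using (⊥-elim)
open import Function using (_∘_)
open import Relation.Nullary using (yes; no)
open import Relation.Binary.Definitions using (tri<; tri≈; tri>)
open import Relation.Binary.Structures using (IsStrictTotalOrder)
open import Relation.Binary.Bundles using (StrictPartialOrder)
import Relation.Binary.Construct.StrictToNonStrict as NonStrict
import Relation.Binary.Reasoning.StrictPartialOrder as OrderReasoning
import Algebra.Properties.Ring as RingProperties
import Algebra.Properties.Group as GroupProperties

module OrderedFieldProperties {c ℓ : Level} (F : OrderedField c ℓ) where
  open OrderedField F hiding (zero)
  open IsStrictTotalOrder <-isStrictTotalOrder
    using (compare; _<?_; irrefl; asym; <-resp-≈; isStrictPartialOrder)
    renaming (trans to <-trans)
  open RingProperties ring using (x[y-z]≈xy-xz; -‿+-comm)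
  open GroupProperties +-group using (//-rightDividesˡ)

  strictPartialOrder : StrictPartialOrder c ℓ ℓ
  strictPartialOrder = record { isStrictPartialOrder = isStrictPartialOrder }

  open OrderReasoning strictPartialOrder

  ≤-trans : ∀ {x y z} → x ≤ y → y ≤ z → x ≤ z
  ≤-trans = NonStrict.trans _≈_ _<_ isEquivalence <-resp-≈ <-trans

  ≤-respʳ-≈ : ∀ {x y z} → y ≈ z → x ≤ y → x ≤ z
  ≤-respʳ-≈ = NonStrict.≤-respʳ-≈ _≈_ _<_ trans (proj₁ <-resp-≈)

  x<y⇒0<y-x : ∀ {x y} → x < y → 0# < y - x
  x<y⇒0<y-x {x} {y} x<y = begin-strict
    0#      ≈⟨ -‿inverseʳ x ⟨
    x - x   <⟨ +-monoˡ-< (- x) x<y ⟩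
    y - x   ∎

  0<y-x⇒x<y : ∀ {x y} → 0# < y - x → x < y
  0<y-x⇒x<y {x} {y} 0<y-x = begin-strict
    x            ≈⟨ +-identityˡ x ⟨
    0# + x       <⟨ +-monoˡ-< x 0<y-x ⟩
    (y - x) + x  ≈⟨ //-rightDividesˡ x y ⟩
    y            ∎

  x≤y⇒0≤y-x : ∀ {x y} → x ≤ y → 0# ≤ y - x
  x≤y⇒0≤y-x (inj₁ x<y) = inj₁ (x<y⇒0<y-x x<y)
  x≤y⇒0≤y-x {x} (inj₂ x≈y) = inj₂ (trans (sym (-‿inverseʳ x)) (+-congʳ x≈y))

  x-[y+z]≈x-y-z : ∀ x y z → x - (y + z) ≈ (x - y) - z
  x-[y+z]≈x-y-z x y z = begin-equality
    x - (y + z)       ≈⟨ +-congˡ (-‿+-comm y z) ⟨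
    x + (- y + - z)   ≈⟨ +-assoc x (- y) (- z) ⟨
    (x - y) - z       ∎

  x+y<z⇒0<z-x-y : ∀ {x y z} → x + y < z → 0# < (z - x) - y
  x+y<z⇒0<z-x-y {x} {y} {z} x+y<z = begin-strict
    0#           <⟨ x<y⇒0<y-x x+y<z ⟩
    z - (x + y)  ≈⟨ x-[y+z]≈x-y-z z x y ⟩
    (z - x) - y  ∎

  *-monoˡ-< : ∀ {k x y} → 0# < k → x < y → k * x < k * y
  *-monoˡ-< {k} {x} {y} 0<k x<y = 0<y-x⇒x<y (begin-strict
    0#             <⟨ *-pos 0<k (x<y⇒0<y-x x<y) ⟩
    k * (y - x)    ≈⟨ x[y-z]≈xy-xz k y x ⟩
    k * y - k * x  ∎)

  *-monoˡ-≤ : ∀ {k x y} → 0# < k → x ≤ y → k * x ≤ k * y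
  *-monoˡ-≤ 0<k (inj₁ x<y) = inj₁ (*-monoˡ-< 0<k x<y)
  *-monoˡ-≤ 0<k (inj₂ x≈y) = inj₂ (*-congˡ x≈y)

  positiveInverse : ∀ {d} → 0# < d → Σ Carrier λ k → 0# < k × d * k ≈ 1#
  positiveInverse {d} 0<d with inverse d (λ d≈0 → irrefl (sym d≈0) 0<d)
  ... | k , dk≈1 with compare 0# k
  ...   | tri< 0<k _ _ = k , 0<k , dk≈1
  ...   | tri≈ _ 0≈k _ = ⊥-elim (irrefl (sym 1≈0) 0<1)
    where
    1≈0 : 1# ≈ 0#
    1≈0 = begin-equality
      1#      ≈⟨ dk≈1 ⟨
      d * k   ≈⟨ *-congˡ 0≈k ⟨
      d * 0#  ≈⟨ zeroʳ d ⟩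
      0#      ∎
  ...   | tri> _ _ k<0 = ⊥-elim (asym 0<1 1<0)
    where
    1<0 : 1# < 0#
    1<0 = begin-strict
      1#      ≈⟨ dk≈1 ⟨
      d * k   <⟨ *-monoˡ-< 0<d k<0 ⟩
      d * 0#  ≈⟨ zeroʳ d ⟩
      0#      ∎

  1≤inverse*lowerBound : ∀ {δ k g} → 0# < k → δ * k ≈ 1# → δ ≤ g → 1# ≤ k * g
  1≤inverse*lowerBound {δ} {k} {g} 0<k δk≈1 δ≤g = begin
    1#     ≈⟨ δk≈1 ⟨
    δ * k  ≈⟨ *-comm δ k ⟩
    k * δ  ≤⟨ *-monoˡ-≤ 0<k δ≤g ⟩
    k * g  ∎

  PositiveLowerBound : ∀ {a} {I : Set a} → (I → Carrier) → Set (c ⊔ ℓ ⊔ a)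
  PositiveLowerBound g = Σ Carrier λ δ → 0# < δ × (∀ i → 0# < g i → δ ≤ g i)

  positiveMin : ∀ {x y} → 0# < x → 0# < y → Σ Carrier λ z → 0# < z × z ≤ x × z ≤ y
  positiveMin {x} {y} 0<x 0<y with compare x y
  ... | tri< x<y _ _ = x , 0<x , inj₂ refl , inj₁ x<y
  ... | tri≈ _ x≈y _ = x , 0<x , inj₂ refl , inj₂ x≈y
  ... | tri> _ _ y<x = y , 0<y , inj₁ y<x , inj₂ refl

  positiveLowerBound-⊎ : ∀ {a b} {I : Set a} {J : Set b} {g : I → Carrier} {h : J → Carrier} →
    PositiveLowerBound g → PositiveLowerBound h → PositiveLowerBound [ g , h ]
  positiveLowerBound-⊎ (δ , 0<δ , δ≤g) (ε , 0<ε , ε≤h) with positiveMin 0<δ 0<ε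
  ... | η , 0<η , η≤δ , η≤ε = η , 0<η , λ
    { (inj₁ i) 0<gi → ≤-trans η≤δ (δ≤g i 0<gi)
    ; (inj₂ j) 0<hj → ≤-trans η≤ε (ε≤h j 0<hj)
    }

  positiveLowerBound-Fin : ∀ {m} (g : Fin m → Carrier) → PositiveLowerBound g
  positiveLowerBound-Fin {Nat.zero} g = 1# , 0<1 , λ ()
  positiveLowerBound-Fin {Nat.suc m} g with positiveLowerBound-Fin (g ∘ suc) | 0# <? g zero
  ... | δ , 0<δ , δ≤g∘suc | no ¬0<g0 = δ , 0<δ , λ
    { zero 0<g0 → ⊥-elim (¬0<g0 0<g0)
    ; (suc i) → δ≤g∘suc i
    }
  ... | δ , 0<δ , δ≤g∘suc | yes 0<g0 with positiveMin 0<g0 0<δ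
  ...   | η , 0<η , η≤g0 , η≤δ = η , 0<η , λ
    { zero _ → η≤g0
    ; (suc i) 0<gi → ≤-trans η≤δ (δ≤g∘suc i 0<gi)
    }

  positiveLowerBound-× : ∀ {m b} {B : Set b} (g : Fin m → B → Carrier) →
    (∀ i → PositiveLowerBound (g i)) → PositiveLowerBound (uncurry g)
  positiveLowerBound-× g bound with positiveLowerBound-Fin (proj₁ ∘ bound)
  ... | δ , 0<δ , δ≤bound = δ , 0<δ , λ (i , x) 0<gix →
    let (δᵢ , 0<δᵢ , δᵢ≤gi) = bound i in ≤-trans (δ≤bound i 0<δᵢ) (δᵢ≤gi x 0<gix)

module Spectral {c ℓ : Level} (F : OrderedField c ℓ) where
  open OrderedField F
  open RingProperties ring using (x[y-z]≈xy-xz)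
  open OrderedFieldProperties F

  -- the quantities that conditions (i), (ii) and (iv) of P(a) bound below by 1
  spectralGaps : ∀ {n} → (Fin n → Carrier) →
    Fin n ⊎ (Fin n × Fin n) ⊎ (Fin n × Fin n × Fin n) → Carrier
  spectralGaps a = [ a , [ (λ (i , j) → a j - a i) , (λ (i , j , k) → (a k - a i) - a j) ] ]

  spectralGaps-positiveLowerBound : ∀ {n} (a : Fin n → Carrier) →
    PositiveLowerBound (spectralGaps a)
  spectralGaps-positiveLowerBound a =
    positiveLowerBound-⊎ (positiveLowerBound-Fin a) (positiveLowerBound-⊎
      (positiveLowerBound-× _ (λ i → positiveLowerBound-Fin _))
      (positiveLowerBound-× _ (λ i → positiveLowerBound-× _ (λ j → positiveLowerBound-Fin _))))

  scaled-inSpectralPolyhedron : ∀ {n κ} {a : Fin n → Carrier} → IsSpectrum F n a → 0# < κ →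
    (∀ t → 0# < spectralGaps a t → 1# ≤ κ * spectralGaps a t) →
    InSpectralPolyhedron F n a (λ i → κ * a i)
  scaled-inSpectralPolyhedron {κ = κ} {a} (0<a , a-increasing) 0<κ 1≤κ*gap =
      (λ i → 1≤κ*gap (inj₁ i) (0<a i))
    , (λ i j i<j → ≤-respʳ-≈ (x[y-z]≈xy-xz κ (a j) (a i))
        (1≤κ*gap (inj₂ (inj₁ (i , j))) (x<y⇒0<y-x (a-increasing i j i<j))))
    , (λ i j k _ _ ak≤ai+aj → x≤y⇒0≤y-x
        (≤-respʳ-≈ (distribˡ κ (a i) (a j)) (*-monoˡ-≤ 0<κ ak≤ai+aj)))
    , (λ i j k _ _ ai+aj<ak → ≤-respʳ-≈ (κ[x-y-z]≈κx-κy-κz (a k) (a i) (a j))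
        (1≤κ*gap (inj₂ (inj₂ (i , j , k)))
          (x+y<z⇒0<z-x-y ai+aj<ak)))
    where
    κ[x-y-z]≈κx-κy-κz : ∀ x y z → κ * ((x - y) - z) ≈ (κ * x - κ * y) - κ * z
    κ[x-y-z]≈κx-κy-κz x y z = trans (x[y-z]≈xy-xz κ (x - y) z) (+-congʳ (x[y-z]≈xy-xz κ x y))

open import Data.Nat using (ℕ; _≤_)

mainTheorem3 : ∀ {c ℓ : Level} (F : OrderedField c ℓ) (n : ℕ) → 1 ≤ n →
    (x : Fin n → OrderedField.Carrier F) → IsSpectrum F n x →
    SpectralPolyhedronNonempty F n x
mainTheorem3 F n _ x spectrum =
  let open OrderedField F using (_*_)
      open OrderedFieldProperties F
      open Spectral F
      (δ , 0<δ , δ≤gaps) = spectralGaps-positiveLowerBound x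
      (κ , 0<κ , δκ≈1) = positiveInverse 0<δ
  in (λ i → κ * x i)
   , scaled-inSpectralPolyhedron spectrum 0<κ
       (λ t 0<gap → 1≤inverse*lowerBound 0<κ δκ≈1 (δ≤gaps t 0<gap))
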